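{- If $S$ is a numerical semigroup, then $\mathrm{C}(S)=\left\lfloor \frac{\mathrm{F}(S)}{\mathrm{m}(S)}\right\rfloor+1$.
   Context: A numerical semigroup is a subset $S\subseteq\mathbb{N}=\{0,1,2,\dots\}$ containing $0$, closed under addition, with $\mathbb{N}\setminus S$ finite. $\mathrm{F}(S)=\max(\mathbb{Z}\setminus S)$ and $\mathrm{m}(S)=\min(S\setminus\{0\})$; $\lfloor q\rfloor=\max\{z\in\mathbb{Z}\mid z\le q\}$. For a numerical semigroup $\Delta$, an ideal of $\Delta$ is a nonempty $I\subseteq\Delta$ with $I+\Delta\subseteq I$. $\mathcal{J}(\Delta)$ is the set of numerical semigroups $S$ such that $S\setminus\{0\}$ is an ideal of $\Delta$; for a family $\mathscr{F}$, $\mathcal{J}(\mathscr{F})=\bigcup_{\Delta\in\mathscr{F}}\mathcal{J}(\Delta)$. Set $\mathcal{J}^0(\mathbb{N})=\{\mathbb{N}\}$, $\mathcal{J}^{k+1}(\mathbb{N})=\mathcal{J}(\mathcal{J}^k(\mathbb{N}))$. The complexity is $\mathrm{C}(S)=\min\{k\in\mathbb{N}\mid S\in\mathcal{J}^k(\mathbb{N})\}$. -}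

module Defs where

open import Data.Bool using (Bool; true; false)
open import Data.Nat as ℕ using (ℕ; zero; suc; _≤_)
open import Data.Integer as ℤ using (ℤ; +_; -[1+_])
open import Data.Empty using (⊥)
open import Data.Product using (Σ; _×_)
open import Relation.Nullary using (¬_)
open import Relation.Binary.PropositionalEquality using (_≡_; _≢_)

SubsetN : Set
SubsetN = ℕ → Bool

_∈_ : ℕ → SubsetN → Set
x ∈ S = S x ≡ true

_∉_ : ℕ → SubsetN → Set
x ∉ S = ¬ (x ∈ S)

_∈ℤ_ : ℤ → SubsetN → Set
(+ n) ∈ℤ S = n ∈ S
-[1+ n ] ∈ℤ S = ⊥

-- S is a numerical semigroup: 0 ∈ S, closed under +, ℕ \ S finite
-- (finiteness expressed as: some bound b with every x ≥ b in S).
record IsNumericalSemigroup (S : SubsetN) : Set where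
  field
    zero∈    : 0 ∈ S
    +-closed : ∀ x y → x ∈ S → y ∈ S → (x ℕ.+ y) ∈ S
    cofinite : Σ ℕ (λ b → ∀ x → b ≤ x → x ∈ S)

IsFrobeniusNumber : SubsetN → ℤ → Set
IsFrobeniusNumber S f = ¬ (f ∈ℤ S) × (∀ z → f ℤ.< z → z ∈ℤ S)

IsMultiplicity : SubsetN → ℕ → Set
IsMultiplicity S m = (m ∈ S × m ≢ 0) × (∀ x → x ∈ S → x ≢ 0 → m ≤ x)

IsIdeal : SubsetN → (ℕ → Set) → Set
IsIdeal Δ I = Σ ℕ I × (∀ x → I x → x ∈ Δ) × (∀ x y → I x → y ∈ Δ → I (x ℕ.+ y))

NonzeroPart : SubsetN → ℕ → Set
NonzeroPart S x = x ∈ S × x ≢ 0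

InJ : ℕ → SubsetN → Set
InJ zero    S = ∀ x → x ∈ S
InJ (suc k) S = IsNumericalSemigroup S ×
                Σ SubsetN (λ Δ → InJ k Δ × IsIdeal Δ (NonzeroPart S))

IsComplexity : SubsetN → ℕ → Set
IsComplexity S k = InJ k S × (∀ j → InJ j S → k ≤ j)

{-# OPTIONS --safe #-}
-- S ∈ 𝒥ᵏ(ℕ) exactly when S contains every x ≥ k·m, where m = m(S).  If
-- S ∖ {0} is an ideal of some Δ ∈ 𝒥ᵏ⁻¹(ℕ), then m ∈ Δ, so for x ≥ k·m
-- inductively x − m ∈ Δ and hence x = m + (x − m) ∈ S.  Conversely, if S contains
-- everything from d ≤ k·m on, then S ∖ {0} is an ideal of Δ = S ∪ [d − m, ∞):
-- a nonzero element of S below d is at least m, so adding an element ≥ d − m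
-- to it lands in [d, ∞).  Δ contains everything from d − m ≤ (k − 1)·m on, so
-- the construction iterates down to ℕ.  Hence C(S) is the least k with
-- F(S) < k·m, namely ⌊F(S)/m⌋ + 1.
module Submission where

open import Defs
open import Data.Nat using (ℕ; NonZero)
open import Data.Integer using (ℤ; +_; _+_; _/ℕ_)
open import Data.Product using (Σ; _×_)
open import Relation.Binary.PropositionalEquality using (_≡_)

open import Data.Bool using (true)
open import Data.Nat using (zero; suc; _≤_; _<_; _∸_; _*_; _≤?_; _<?_; z≤n; s≤s)
open import Data.Nat.Properties
  using (≤-refl; ≤-trans; <-≤-trans; module ≤-Reasoning; <⇒≱; ≰⇒>; ≮⇒≥;
         m≤m+n; m≤n+m; n≤1+n; +-comm; +-mono-≤; +-monoˡ-<; m+n≡0⇒m≡0;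
         m∸n≤m; m≤n+o⇒m∸n≤o; m≤n+m∸n; m+[n∸m]≡n; m+n∸m≡n; ∸-monoˡ-≤)
open import Data.Nat.DivMod
  using (_/_; _%_; m≡m%n+[m/n]*n; m%n<n; m<n*o⇒m/o<n; m<n⇒m%n≡m; m<n⇒m/n≡0)
import Data.Integer as ℤ
import Data.Nat as ℕ
open import Data.Product using (_,_; proj₁)
open import Data.Sum using (_⊎_; inj₁; inj₂)
open import Data.Empty using (⊥-elim)
open import Function.Base using (_∘_)
open import Function.Bundles using (_⇔_; mk⇔; Equivalence)
open import Relation.Nullary using (yes; no)
open import Relation.Binary.PropositionalEquality using (refl; sym; subst; cong; _≢_)

ContainsFrom : SubsetN → ℕ → Set
ContainsFrom U d = ∀ x → d ≤ x → x ∈ U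

NonzeroBelowAtLeast : SubsetN → ℕ → ℕ → Set
NonzeroBelowAtLeast U d m = ∀ x → x ∈ U → x ≢ 0 → x < d → m ≤ x

infixl 25 _∪≥_

_∪≥_ : SubsetN → ℕ → SubsetN
(U ∪≥ c) x with c ≤? x
... | yes _ = true
... | no  _ = U x

∈-∪≥ˡ : ∀ U c x → x ∈ U → x ∈ U ∪≥ c
∈-∪≥ˡ U c x x∈U with c ≤? x
... | yes _ = refl
... | no  _ = x∈U

∈-∪≥ʳ : ∀ U c → ContainsFrom (U ∪≥ c) c
∈-∪≥ʳ U c x c≤x with c ≤? x
... | yes _   = refl
... | no  c≰x = ⊥-elim (c≰x c≤x)

∈-∪≥⁻ : ∀ U c x → x ∈ U ∪≥ c → x ∈ U ⊎ c ≤ x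
∈-∪≥⁻ U c x x∈ with c ≤? x
... | yes c≤x = inj₂ c≤x
... | no  _   = inj₁ x∈

x+y≢0 : ∀ x y → x ≢ 0 → x ℕ.+ y ≢ 0
x+y≢0 x y x≢0 x+y≡0 = x≢0 (m+n≡0⇒m≡0 x x+y≡0)

∪≥-isNumericalSemigroup : ∀ {U} c → IsNumericalSemigroup U → IsNumericalSemigroup (U ∪≥ c)
∪≥-isNumericalSemigroup {U} c ns = record
  { zero∈    = ∈-∪≥ˡ U c 0 zero∈
  ; +-closed = closed
  ; cofinite = c , ∈-∪≥ʳ U c
  }
  where
  open IsNumericalSemigroup ns
  closed : ∀ x y → x ∈ U ∪≥ c → y ∈ U ∪≥ c → (x ℕ.+ y) ∈ U ∪≥ c
  closed x y x∈ y∈ with ∈-∪≥⁻ U c x x∈ | ∈-∪≥⁻ U c y y∈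
  ... | inj₁ x∈U | inj₁ y∈U = ∈-∪≥ˡ U c _ (+-closed x y x∈U y∈U)
  ... | inj₂ c≤x | _        = ∈-∪≥ʳ U c _ (≤-trans c≤x (m≤m+n x y))
  ... | inj₁ _   | inj₂ c≤y = ∈-∪≥ʳ U c _ (≤-trans c≤y (m≤n+m y x))

nonzeroPart-isIdeal : ∀ {U d m} → IsNumericalSemigroup U → ContainsFrom U d →
                      NonzeroBelowAtLeast U d m → IsIdeal (U ∪≥ (d ∸ m)) (NonzeroPart U)
nonzeroPart-isIdeal {U} {d} {m} ns U⊇d small =
  (suc d , U⊇d (suc d) (n≤1+n d) , λ ()) , (λ x → ∈-∪≥ˡ U (d ∸ m) x ∘ proj₁) , absorbs
  where
  open IsNumericalSemigroup ns
  absorbs : ∀ x y → NonzeroPart U x → y ∈ U ∪≥ (d ∸ m) → NonzeroPart U (x ℕ.+ y)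
  absorbs x y (x∈U , x≢0) y∈ with ∈-∪≥⁻ U (d ∸ m) y y∈ | x <? d
  ... | inj₁ y∈U   | _     = +-closed x y x∈U y∈U , x+y≢0 x y x≢0
  ... | inj₂ d∸m≤y | yes x<d =
    U⊇d _ (≤-trans (m≤n+m∸n d m) (+-mono-≤ (small x x∈U x≢0 x<d) d∸m≤y)) , x+y≢0 x y x≢0
  ... | inj₂ _     | no  x≮d = U⊇d _ (≤-trans (≮⇒≥ x≮d) (m≤m+n x y)) , x+y≢0 x y x≢0

∪≥-nonzeroBelowAtLeast : ∀ {U d m} → NonzeroBelowAtLeast U d m →
                         NonzeroBelowAtLeast (U ∪≥ (d ∸ m)) (d ∸ m) m
∪≥-nonzeroBelowAtLeast {U} {d} {m} small x x∈ x≢0 x<d∸m with ∈-∪≥⁻ U (d ∸ m) x x∈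
... | inj₁ x∈U   = small x x∈U x≢0 (<-≤-trans x<d∸m (m∸n≤m d m))
... | inj₂ d∸m≤x = ⊥-elim (<⇒≱ x<d∸m d∸m≤x)

InJ-if-containsFrom : ∀ k {U d m} → IsNumericalSemigroup U → ContainsFrom U d →
                      NonzeroBelowAtLeast U d m → d ≤ k * m → InJ k U
InJ-if-containsFrom zero    ns U⊇d _ d≤0 x = U⊇d x (≤-trans d≤0 z≤n)
InJ-if-containsFrom (suc k) {U} {d} {m} ns U⊇d small d≤ =
  ns , U ∪≥ (d ∸ m) ,
  InJ-if-containsFrom k (∪≥-isNumericalSemigroup (d ∸ m) ns) (∈-∪≥ʳ U (d ∸ m))
    (∪≥-nonzeroBelowAtLeast small) (m≤n+o⇒m∸n≤o d m d≤) ,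
  nonzeroPart-isIdeal ns U⊇d small

containsFrom-if-InJ : ∀ k {S m} → InJ k S → m ∈ S → m ≢ 0 → ContainsFrom S (k * m)
containsFrom-if-InJ zero    S=ℕ _ _ x _ = S=ℕ x
containsFrom-if-InJ (suc k) {S} {m} (_ , Δ , Δ∈J , _ , S⊆Δ , absorbs) m∈S m≢0 x k*m≤x =
  subst (_∈ S) (m+[n∸m]≡n m≤x) (proj₁ (absorbs m (x ∸ m) (m∈S , m≢0) x∸m∈Δ))
  where
  m≤x : m ≤ x
  m≤x = ≤-trans (m≤m+n m (k * m)) k*m≤x
  x∸m∈Δ : (x ∸ m) ∈ Δ
  x∸m∈Δ = containsFrom-if-InJ k Δ∈J (S⊆Δ m (m∈S , m≢0)) m≢0 (x ∸ m)
            (subst (_≤ x ∸ m) (m+n∸m≡n m (k * m)) (∸-monoˡ-≤ m k*m≤x))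

InJ⇔containsFrom : ∀ {S m} k → IsNumericalSemigroup S → IsMultiplicity S m →
                   InJ k S ⇔ ContainsFrom S (k * m)
InJ⇔containsFrom {m = m} k ns ((m∈S , m≢0) , m-least) = mk⇔
  (λ S∈J → containsFrom-if-InJ k S∈J m∈S m≢0)
  (λ S⊇ → InJ-if-containsFrom k {m = m} ns S⊇ (λ x x∈S x≢0 _ → m-least x x∈S x≢0) ≤-refl)

isComplexity-if-leastContainsFrom :
  ∀ {S m} k → IsNumericalSemigroup S → IsMultiplicity S m → ContainsFrom S (k * m) →
  (∀ j → ContainsFrom S (j * m) → k ≤ j) → IsComplexity S k
isComplexity-if-leastContainsFrom k ns mult S⊇ least =
  Equivalence.from (InJ⇔containsFrom k ns mult) S⊇ ,
  λ j S∈J → least j (Equivalence.to (InJ⇔containsFrom j ns mult) S∈J)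

containsFrom⇔frobenius< : ∀ {S F} → IsFrobeniusNumber S (+ F) → ∀ d → ContainsFrom S d ⇔ F < d
containsFrom⇔frobenius< {F = F} (F∉S , above) d = mk⇔
  (λ S⊇ → ≰⇒> (λ d≤F → F∉S (S⊇ F d≤F)))
  (λ F<d x d≤x → above (+ x) (ℤ.+<+ (<-≤-trans F<d d≤x)))

m<[1+m/n]*n : ∀ m n .{{_ : NonZero n}} → m < suc (m / n) * n
m<[1+m/n]*n m n = begin-strict
  m                    ≡⟨ m≡m%n+[m/n]*n m n ⟩
  m % n ℕ.+ m / n * n  <⟨ +-monoˡ-< (m / n * n) (m%n<n m n) ⟩
  n ℕ.+ m / n * n      ∎
  where open ≤-Reasoning

-1/ℕn≡-1 : ∀ n .{{_ : NonZero n}} → ℤ.-1ℤ /ℕ n ≡ ℤ.-1ℤ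
-1/ℕn≡-1 (suc zero)    = refl
-1/ℕn≡-1 (suc (suc n)) rewrite m<n⇒m%n≡m {n = suc (suc n)} {m = 1} (s≤s (s≤s z≤n))
                             | m<n⇒m/n≡0 {m = 1} {n = suc (suc n)} (s≤s (s≤s z≤n)) = refl

corollary22 : (S : SubsetN) → IsNumericalSemigroup S →
    (f : ℤ) (m : ℕ) .{{_ : NonZero m}} →
    IsFrobeniusNumber S f → IsMultiplicity S m →
    Σ ℕ (λ k → IsComplexity S k × (+ k ≡ (f /ℕ m) + + 1))
corollary22 S ns (+ F) m frob mult =
  suc (F / m) ,
  isComplexity-if-leastContainsFrom (suc (F / m)) ns mult
    (Equivalence.from (containsFrom⇔frobenius< frob _) (m<[1+m/n]*n F m))
    (λ j S⊇ → m<n*o⇒m/o<n (Equivalence.to (containsFrom⇔frobenius< frob _) S⊇)) ,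
  cong +_ (+-comm 1 (F / m))
corollary22 S _ ℤ.-[1+ zero ] m (_ , above) _ =
  0 , ((λ x → above (+ x) ℤ.-<+) , (λ _ _ → z≤n)) , sym (cong (_+ + 1) (-1/ℕn≡-1 m))
corollary22 S _ ℤ.-[1+ suc _ ] _ (_ , above) _ =
  ⊥-elim (above ℤ.-1ℤ (ℤ.-<- (s≤s z≤n)))
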